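{- Let $G$ be a graph and let $n\geq 4$ be an integer. Then \[\operatorname{Z}(G\times K_n)\le (n-2)|V(G)| + 2\operatorname{Z}^-(G).\]
   Context: All graphs are finite, simple and undirected. $K_n$ is the complete graph on $n$ vertices. The tensor product $G\times H$ has vertex set $V(G)\times V(H)$, with $(g,h)$ adjacent to $(g',h')$ iff $g\sim g'$ in $G$ and $h\sim h'$ in $H$. Zero forcing: vertices are colored blue or white; the color change rule says that if a blue vertex $u$ has exactly one white neighbor $w$, then $w$ is changed to blue. A zero forcing set is a set $B$ of vertices such that, coloring $B$ blue and all other vertices white, repeated application of the color change rule eventually colors all vertices blue; $\operatorname{Z}(G)$ is the minimum cardinality of a zero forcing set. Skew zero forcing: the skew color change rule says that if any vertex $v$ (blue or white) has exactly one white neighbor $w$, then $w$ is changed to blue. A skew zero forcing set is a (possibly empty) set of initially blue vertices from which repeated application of the skew color change rule colors all vertices blue; $\operatorname{Z}^-(G)$ is the minimum cardinality of a skew zero forcing set. -}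

module Defs where

open import Data.Nat using (ℕ; _*_; _≤_)
open import Data.Bool using (Bool; true; false; _∧_; not)
open import Data.Fin using (Fin; remQuot)
open import Data.Fin.Subset using (Subset; _∈_; ∣_∣)
open import Data.Fin.Properties using (_≟_)
open import Data.Product using (_×_; proj₁; proj₂; ∃-syntax)
open import Relation.Binary.PropositionalEquality using (_≡_; _≢_; refl; cong₂)
open import Relation.Nullary using (does)

record Graph : Set where
  field
    order  : ℕ
    adj    : Fin order → Fin order → Bool
    sym    : ∀ u v → adj u v ≡ adj v u
    irrefl : ∀ v → adj v v ≡ false
open Graph public

Adj : (G : Graph) → Fin (order G) → Fin (order G) → Set
Adj G u v = adj G u v ≡ true

private
  ≟-sym : ∀ {n} (u v : Fin n) → does (u ≟ v) ≡ does (v ≟ u)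
  ≟-sym u v with u ≟ v | v ≟ u
  ... | Relation.Nullary.yes _ | Relation.Nullary.yes _ = refl
  ... | Relation.Nullary.no _  | Relation.Nullary.no _  = refl
  ... | Relation.Nullary.yes p | Relation.Nullary.no q  = Data.Empty.⊥-elim (q (Relation.Binary.PropositionalEquality.sym p))
    where import Data.Empty
  ... | Relation.Nullary.no p  | Relation.Nullary.yes q = Data.Empty.⊥-elim (p (Relation.Binary.PropositionalEquality.sym q))
    where import Data.Empty

  ≟-refl : ∀ {n} (v : Fin n) → does (v ≟ v) ≡ true
  ≟-refl v with v ≟ v
  ... | Relation.Nullary.yes _ = refl
  ... | Relation.Nullary.no p  = Data.Empty.⊥-elim (p refl)
    where import Data.Empty

K : ℕ → Graph
K n = record
  { order  = n
  ; adj    = λ u v → not (does (u ≟ v))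
  ; sym    = λ u v → Relation.Binary.PropositionalEquality.cong not (≟-sym u v)
  ; irrefl = λ v → Relation.Binary.PropositionalEquality.cong not (≟-refl v)
  }

-- Tensor product G × H.  Its vertex set Fin (|G| * |H|) is identified with
-- Fin |G| × Fin |H| via the bijection remQuot (inverse: Data.Fin.combine).
private
  ∧-false : ∀ (a : Bool) → false ∧ a ≡ false
  ∧-false a = refl

fstV : (G H : Graph) → Fin (order G * order H) → Fin (order G)
fstV G H i = proj₁ (remQuot {order G} (order H) i)

sndV : (G H : Graph) → Fin (order G * order H) → Fin (order H)
sndV G H i = proj₂ (remQuot {order G} (order H) i)

_⊗_ : Graph → Graph → Graph
G ⊗ H = record
  { order  = order G * order H
  ; adj    = λ i j → adj G (fstV G H i) (fstV G H j) ∧ adj H (sndV G H i) (sndV G H j)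
  ; sym    = λ i j → cong₂ _∧_ (sym G (fstV G H i) (fstV G H j)) (sym H (sndV G H i) (sndV G H j))
  ; irrefl = λ i → Relation.Binary.PropositionalEquality.cong (_∧ adj H (sndV G H i) (sndV G H i)) (irrefl G (fstV G H i))
  }

data Blue (G : Graph) (B : Subset (order G)) : Fin (order G) → Set where
  init  : ∀ {v} → v ∈ B → Blue G B v
  force : ∀ u w → Blue G B u → Adj G u w
        → (∀ x → Adj G u x → x ≢ w → Blue G B x) → Blue G B w

data SkewBlue (G : Graph) (B : Subset (order G)) : Fin (order G) → Set where
  init  : ∀ {v} → v ∈ B → SkewBlue G B v
  force : ∀ v w → Adj G v w
        → (∀ x → Adj G v x → x ≢ w → SkewBlue G B x) → SkewBlue G B w

IsZeroForcingSet : (G : Graph) → Subset (order G) → Set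
IsZeroForcingSet G B = ∀ v → Blue G B v

IsSkewZeroForcingSet : (G : Graph) → Subset (order G) → Set
IsSkewZeroForcingSet G B = ∀ v → SkewBlue G B v

IsZ : Graph → ℕ → Set
IsZ G k = (∃[ B ] (∣ B ∣ ≡ k × IsZeroForcingSet G B))
        × (∀ B → IsZeroForcingSet G B → k ≤ ∣ B ∣)

IsZ⁻ : Graph → ℕ → Set
IsZ⁻ G k = (∃[ B ] (∣ B ∣ ≡ k × IsSkewZeroForcingSet G B))
         × (∀ B → IsSkewZeroForcingSet G B → k ≤ ∣ B ∣)

-- Fix a skew zero forcing set S of G and the order in which the skew forcing
-- process colours the vertices of G.  In G × K_n colour the whole fibre of each
-- vertex of S, and all of the fibre of any other vertex w except two positions:
-- positions {0,1} or {2,3} of K_n, according to a colour of w.  If v forces w in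
-- G and {a , a′} are the white positions of w, then (v , a′) forces (w , a) as soon
-- as (v , a′) is blue; the colouring is chosen so that either a′ is not white in
-- the fibre of v, or v is coloured before w.  This blue set has
-- (n − 2)|V(G)| + 2|S| vertices.
module Submission where

open import Defs hiding (sym)
open import Data.Bool using (Bool; true; false; not; if_then_else_)
import Data.Bool as Bool
open import Data.Bool.Properties using (T-≡)
open import Data.Empty using (⊥-elim)
open import Data.Fin using (Fin; zero; suc; toℕ; combine; remQuot)
open import Data.Fin.Properties using (_≟_; toℕ<n; toℕ-injective; remQuot-combine; combine-remQuot; any?; all?)
open import Data.Fin.Subset using (Subset; inside; outside; ⊤; _∈_; _∉_; _⊆_; ∣_∣)
open import Data.Fin.Subset.Properties using (_∈?_; ∈⊤; ∣⊤∣≡n)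
open import Data.Nat using (ℕ; _∸_; zero; suc; _+_; _*_; _⊔_; _≤_; _<_; _≮_; _≤′_; ≤′-refl; ≤′-step; z≤n; s≤s; _<ᵇ_)
open import Data.Nat.Induction using (<-wellFounded)
open import Data.Nat.Properties
  using (≤⇒≤′; ≮⇒≥; <ᵇ⇒<; <⇒<ᵇ; <-cmp; <⇒≢; <-asym; <-trans; n<1+n; m<1+n⇒m<n∨m≡n; m≤m⊔n; m≤n⊔m;
         m≤m+n; +-comm; +-identityʳ; *-zeroʳ; +-monoʳ-<; *-monoˡ-≤; +-cancelˡ-≡; module ≤-Reasoning)
open import Data.Nat.Tactic.RingSolver using (solve-∀)
open import Data.Product using (∃-syntax; _×_; _,_; proj₁; proj₂; uncurry)
open import Data.Sum using (_⊎_; inj₁; inj₂; [_,_]′)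
open import Data.Vec using (Vec; []; _∷_; here; there; _++_; concat; lookup; tabulate)
open import Data.Vec.Properties using (lookup-concat; lookup∘tabulate; []=⇒lookup; lookup⇒[]=)
open import Function.Bundles using (Equivalence)
open import Function.Base using (_∘′_)
open import Function.Definitions using (Injective)
open import Induction.WellFounded using (module All)
import Relation.Binary.Construct.On as On
open import Relation.Binary.Definitions using (tri<; tri≈; tri>)
open import Relation.Binary.PropositionalEquality using (_≡_; _≢_; refl; sym; trans; cong; cong₂; subst; module ≡-Reasoning)
open import Relation.Nullary using (¬_; Dec; yes; no; contradiction)
open import Relation.Nullary.Decidable using (dec-false; _×-dec_; _⊎-dec_; _→-dec_; ¬?)
open import Relation.Unary using (Decidable)

module _ (G : Graph) where

  adj? : ∀ u v → Dec (Adj G u v)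
  adj? u v = adj G u v Bool.≟ true

  Adj-sym : ∀ {u v} → Adj G u v → Adj G v u
  Adj-sym {u} {v} = trans (Graph.sym G v u)

  Adj-irrefl : ∀ {v} → ¬ Adj G v v
  Adj-irrefl {v} vv with trans (sym vv) (irrefl G v)
  ... | ()

K-adj⁺ : ∀ {n} {a b : Fin n} → a ≢ b → Adj (K n) a b
K-adj⁺ {a = a} {b} a≢b = cong not (dec-false (a ≟ b) a≢b)

K-adj⁻ : ∀ {n} {a b : Fin n} → Adj (K n) a b → a ≢ b
K-adj⁻ {a = a} ab refl = Adj-irrefl (K _) {a} ab

module _ (G H : Graph) {g h : Fin (order G)} {a b : Fin (order H)} where

  ⊗-adj-combine : adj (G ⊗ H) (combine g a) (combine h b) ≡ (adj G g h Bool.∧ adj H a b)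
  ⊗-adj-combine = cong₂ (λ p q → adj G (proj₁ p) (proj₁ q) Bool.∧ adj H (proj₂ p) (proj₂ q))
                        (remQuot-combine g a) (remQuot-combine h b)

  ⊗-adj⁺ : Adj G g h → Adj H a b → Adj (G ⊗ H) (combine g a) (combine h b)
  ⊗-adj⁺ gh ab rewrite ⊗-adj-combine | gh | ab = refl

  ⊗-adj⁻ : Adj (G ⊗ H) (combine g a) (combine h b) → Adj G g h × Adj H a b
  ⊗-adj⁻ p with adj G g h | adj H a b | trans (sym ⊗-adj-combine) p
  ... | true | true | _ = refl , refl

∀-combine : ∀ {m n} {P : Fin (m * n) → Set} → (∀ g a → P (combine g a)) → ∀ i → P i
∀-combine {m} {n} {P} p i = subst P (combine-remQuot {m} n i) (uncurry p (remQuot {m} n i))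

module ProductForcing (G : Graph) (n : ℕ) (B : Subset (order G * n)) where

  BlueAt : Fin (order G) → Fin n → Set
  BlueAt g a = Blue (G ⊗ K n) B (combine g a)

  product-force : ∀ {v w a b} → Adj G v w → a ≢ b → BlueAt v a
                → (∀ y → Adj G v y → y ≢ w → ∀ l → BlueAt y l)
                → (∀ l → l ≢ a → l ≢ b → BlueAt w l)
                → BlueAt w b
  product-force {v} {w} {a} {b} vw a≢b va others fibre-w =
    force (combine v a) (combine w b) va (⊗-adj⁺ G (K n) vw (K-adj⁺ a≢b))
      (∀-combine {order G} {n} {λ x → Adj (G ⊗ K n) (combine v a) x → x ≢ combine w b → Blue (G ⊗ K n) B x}
                 neighbour-blue)
    where
    neighbour-blue : ∀ y l → Adj (G ⊗ K n) (combine v a) (combine y l)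
                   → combine y l ≢ combine w b → BlueAt y l
    neighbour-blue y l va-yl yl≢wb with ⊗-adj⁻ G (K n) va-yl | y ≟ w
    ... | _  , al | yes refl = fibre-w l (K-adj⁻ al ∘′ sym) (yl≢wb ∘′ cong (combine w))
    ... | vy , _  | no y≢w   = others y vy y≢w l

uniform-bound : ∀ {n} (P : Fin n → ℕ → Set) → (∀ i {k l} → k ≤ l → P i k → P i l)
              → (∀ i → ∃[ k ] P i k) → ∃[ k ] (∀ i → P i k)
uniform-bound {zero}  P mono bound = 0 , λ ()
uniform-bound {suc n} P mono bound
  with bound zero | uniform-bound (λ i → P (suc i)) (λ i → mono (suc i)) (λ i → bound (suc i))
... | k , p₀ | l , ps = k ⊔ l , λ { zero    → mono zero (m≤m⊔n k l) p₀
                                  ; (suc i) → mono (suc i) (m≤n⊔m k l) (ps i) }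

Least : (ℕ → Set) → ℕ → Set
Least P r = P r × (∀ {j} → j < r → ¬ P j)

module _ {P : ℕ → Set} (P? : Decidable P) where

  least-or-none-below : ∀ n → ∃[ r ] Least P r ⊎ (∀ {j} → j < n → ¬ P j)
  least-or-none-below zero = inj₂ λ ()
  least-or-none-below (suc n) with least-or-none-below n
  ... | inj₁ least = inj₁ least
  ... | inj₂ none with P? n
  ...   | yes pn = inj₁ (n , pn , none)
  ...   | no ¬pn = inj₂ λ j<1+n → [ none , (λ { refl → ¬pn }) ]′ (m<1+n⇒m<n∨m≡n j<1+n)

  least-witness : ∀ {n} → P n → ∃[ r ] Least P r
  least-witness {n} pn with least-or-none-below (suc n)
  ... | inj₁ least = least
  ... | inj₂ none  = contradiction pn (none (n<1+n n))

module _ {m} (f : Fin m → ℕ) where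

  tiebreak : Fin m → ℕ
  tiebreak w = f w * m + toℕ w

  tiebreak-mono-< : ∀ {x w} → f x < f w → tiebreak x < tiebreak w
  tiebreak-mono-< {x} {w} fx<fw = begin-strict
    f x * m + toℕ x  <⟨ +-monoʳ-< (f x * m) (toℕ<n x) ⟩
    f x * m + m      ≡⟨ +-comm (f x * m) m ⟩
    suc (f x) * m    ≤⟨ *-monoˡ-≤ m fx<fw ⟩
    f w * m          ≤⟨ m≤m+n (f w * m) (toℕ w) ⟩
    tiebreak w       ∎
    where open ≤-Reasoning

  tiebreak-injective : Injective _≡_ _≡_ tiebreak
  tiebreak-injective {x} {w} eq with <-cmp (f x) (f w)
  ... | tri< fx<fw _ _ = contradiction eq (<⇒≢ (tiebreak-mono-< fx<fw))
  ... | tri> _ _ fw<fx = contradiction (sym eq) (<⇒≢ (tiebreak-mono-< fw<fx))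
  ... | tri≈ _ fx≡fw _ =
    toℕ-injective (+-cancelˡ-≡ (f x * m) _ _ (trans eq (cong (λ t → t * m + toℕ w) (sym fx≡fw))))

Forces : (G : Graph) → (Fin (order G) → Set) → Fin (order G) → Fin (order G) → Set
Forces G T v w = Adj G v w × (∀ x → Adj G v x → x ≢ w → T x)

-- forcer w is meaningless for w ∈ S.
record SkewChronology (G : Graph) (S : Subset (order G)) : Set where
  field
    rank           : Fin (order G) → ℕ
    rank-injective : Injective _≡_ _≡_ rank
    forcer         : Fin (order G) → Fin (order G)
    forcer-forces  : ∀ {w} → w ∉ S → Forces G (λ x → rank x < rank w) (forcer w) w

module SkewRounds (G : Graph) (S : Subset (order G)) where

  Round : ℕ → Fin (order G) → Set
  Round zero    w = w ∈ S
  Round (suc k) w = Round k w ⊎ ∃[ v ] Forces G (Round k) v w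

  round? : ∀ k → Decidable (Round k)
  round? zero    w = w ∈? S
  round? (suc k) w = round? k w ⊎-dec any? λ v →
    adj? G v w ×-dec all? λ x → adj? G v x →-dec ¬? (x ≟ w) →-dec round? k x

  round-mono′ : ∀ {k l} → k ≤′ l → ∀ {w} → Round k w → Round l w
  round-mono′ ≤′-refl       r = r
  round-mono′ (≤′-step k≤l) r = inj₁ (round-mono′ k≤l r)

  skewBlue⇒round : ∀ {w} → SkewBlue G S w → ∃[ k ] Round k w
  skewBlue⇒round (init w∈S) = 0 , w∈S
  skewBlue⇒round (force v w vw others)
    with uniform-bound (λ x k → Adj G v x → x ≢ w → Round k x)
                       (λ x k≤l earlier vx x≢w → round-mono′ (≤⇒≤′ k≤l) (earlier vx x≢w))
                       bound
    where
    bound : ∀ x → ∃[ k ] (Adj G v x → x ≢ w → Round k x)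
    bound x with adj? G v x | x ≟ w
    ... | yes vx | no x≢w = let k , r = skewBlue⇒round (others x vx x≢w) in k , λ _ _ → r
    ... | yes _  | yes x≡w = 0 , λ _ x≢w → contradiction x≡w x≢w
    ... | no ¬vx | _       = 0 , λ vx → contradiction vx ¬vx
  ... | k , earlier = suc k , inj₂ (v , vw , earlier)

  module _ (S-forces : IsSkewZeroForcingSet G S) where

    least-round : ∀ w → ∃[ r ] Least (λ k → Round k w) r
    least-round w = least-witness (λ k → round? k w) (proj₂ (skewBlue⇒round (S-forces w)))

    round : Fin (order G) → ℕ
    round w = proj₁ (least-round w)

    round-reached : ∀ w → Round (round w) w
    round-reached w = proj₁ (proj₂ (least-round w))

    round-minimal : ∀ w {j} → j < round w → ¬ Round j w
    round-minimal w = proj₂ (proj₂ (least-round w))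

    round-≤ : ∀ {k x} → Round k x → round x ≤ k
    round-≤ {x = x} r = ≮⇒≥ λ k<round → round-minimal x k<round r

    forced-in-round : ∀ {w} → w ∉ S → ∃[ v ] Forces G (λ x → round x < round w) v w
    forced-in-round {w} w∉S with round w | round-reached w | round-minimal w
    ... | zero  | w∈S                    | _       = contradiction w∈S w∉S
    ... | suc k | inj₁ r                 | minimal = contradiction r (minimal (n<1+n k))
    ... | suc k | inj₂ (v , vw , others) | _       =
      v , vw , λ x vx x≢w → s≤s (round-≤ (others x vx x≢w))

    forcer : Fin (order G) → Fin (order G)
    forcer w with w ∈? S
    ... | yes _   = w
    ... | no w∉S = proj₁ (forced-in-round w∉S)

    forcer-forces : ∀ {w} → w ∉ S → Forces G (λ x → tiebreak round x < tiebreak round w) (forcer w) w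
    forcer-forces {w} w∉S with w ∈? S
    ... | yes w∈S = contradiction w∈S w∉S
    ... | no w∉S′ with forced-in-round w∉S′
    ...   | _ , vw , earlier = vw , λ x vx x≢w → tiebreak-mono-< round (earlier x vx x≢w)

    skewChronology : SkewChronology G S
    skewChronology = record
      { rank           = tiebreak round
      ; rank-injective = tiebreak-injective round
      ; forcer         = forcer
      ; forcer-forces  = forcer-forces
      }

module Colouring {G : Graph} {S : Subset (order G)} (ch : SkewChronology G S) where
  open SkewChronology ch

  colour : Fin (order G) → Bool
  colour w = rank w <ᵇ rank (forcer w)

  earlier⇒colour : ∀ {w} → rank w < rank (forcer w) → colour w ≡ true
  earlier⇒colour w<u = Equivalence.to T-≡ (<⇒<ᵇ w<u)

  colour⇒earlier : ∀ {w} → colour w ≡ true → rank w < rank (forcer w)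
  colour⇒earlier c = <ᵇ⇒< _ _ (Equivalence.from T-≡ c)

  -- If v = forcer w were later than w and of the same colour, then forcer v would
  -- be later than v, but forcer v is w or another neighbour of v, both earlier.
  same-colour⇒forcer-earlier : ∀ {w} → w ∉ S → forcer w ∉ S → colour (forcer w) ≡ colour w
                             → rank (forcer w) < rank w
  same-colour⇒forcer-earlier {w} w∉S v∉S same with <-cmp (rank (forcer w)) (rank w)
  ... | tri< v<w _ _ = v<w
  ... | tri≈ _ v≡w _ =
    contradiction (subst (λ u → Adj G u w) (rank-injective v≡w) (proj₁ (forcer-forces w∉S))) (Adj-irrefl G)
  ... | tri> _ _ w<v = contradiction (colour⇒earlier (trans same (earlier⇒colour w<v))) v≮u
    where
    v≮u : rank (forcer w) ≮ rank (forcer (forcer w))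
    v≮u v<u with forcer (forcer w) ≟ w
    ... | yes u≡w = <-asym w<v (subst (λ u → rank (forcer w) < rank u) u≡w v<u)
    ... | no u≢w  = <-asym w<v (<-trans v<u (proj₂ (forcer-forces w∉S) _ (Adj-sym G (proj₁ (forcer-forces v∉S))) u≢w))

∣++∣ : ∀ {m n} (p : Subset m) (q : Subset n) → ∣ p ++ q ∣ ≡ ∣ p ∣ + ∣ q ∣
∣++∣ []            q = refl
∣++∣ (inside ∷ p)  q = cong suc (∣++∣ p q)
∣++∣ (outside ∷ p) q = ∣++∣ p q

≡-or-≡not : ∀ b b′ → b′ ≡ b ⊎ b′ ≡ not b
≡-or-≡not false false = inj₁ refl
≡-or-≡not false true  = inj₂ refl
≡-or-≡not true  false = inj₂ refl
≡-or-≡not true  true  = inj₁ refl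

module _ {k : ℕ} where

  -- spare c leaves exactly the positions pair c false and pair c true white.
  spare : Bool → Subset (4 + k)
  spare false = outside ∷ outside ∷ ⊤
  spare true  = inside ∷ inside ∷ outside ∷ outside ∷ ⊤

  pair : Bool → Bool → Fin (4 + k)
  pair false false = zero
  pair false true  = suc zero
  pair true  false = suc (suc zero)
  pair true  true  = suc (suc (suc zero))

  ∣spare∣ : ∀ c → ∣ spare c ∣ ≡ 2 + k
  ∣spare∣ false = ∣⊤∣≡n (2 + k)
  ∣spare∣ true  = cong (2 +_) (∣⊤∣≡n k)

  ∉spare⇒pair : ∀ c j → j ∉ spare c → ∃[ b ] j ≡ pair c b
  ∉spare⇒pair false zero                      _  = false , refl
  ∉spare⇒pair false (suc zero)                _  = true , refl
  ∉spare⇒pair false (suc (suc j))             j∉ = contradiction (there (there ∈⊤)) j∉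
  ∉spare⇒pair true  zero                      j∉ = contradiction here j∉
  ∉spare⇒pair true  (suc zero)                j∉ = contradiction (there here) j∉
  ∉spare⇒pair true  (suc (suc zero))          _  = false , refl
  ∉spare⇒pair true  (suc (suc (suc zero)))    _  = true , refl
  ∉spare⇒pair true  (suc (suc (suc (suc j)))) j∉ = contradiction (there (there (there (there ∈⊤)))) j∉

  pair-≢ : ∀ c b → pair c (not b) ≢ pair c b
  pair-≢ false false ()
  pair-≢ false true  ()
  pair-≢ true  false ()
  pair-≢ true  true  ()

  pair∈spare : ∀ c b {c′} → c′ ≢ c → pair c b ∈ spare c′
  pair∈spare false false {true}  _ = here
  pair∈spare false true  {true}  _ = there here
  pair∈spare true  false {false} _ = there (there ∈⊤)
  pair∈spare true  true  {false} _ = there (there ∈⊤)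
  pair∈spare false _     {false} c′≢c = contradiction refl c′≢c
  pair∈spare true  _     {true}  c′≢c = contradiction refl c′≢c

  spare-⊇ : ∀ c b {l} → l ≢ pair c (not b) → l ≢ pair c b → l ∈ spare c
  spare-⊇ c b {l} l≢b′ l≢b with l ∈? spare c
  ... | yes l∈ = l∈
  ... | no l∉ with ∉spare⇒pair c l l∉
  ...   | b′ , refl = ⊥-elim ([ l≢b ∘′ cong (pair c) , l≢b′ ∘′ cong (pair c) ]′ (≡-or-≡not b b′))

module BlowUp (k : ℕ) where

  fibre : Bool → Bool → Subset (4 + k)
  fibre s c = if s then ⊤ else spare c

  spare⊆fibre : ∀ s c → spare c ⊆ fibre s c
  spare⊆fibre true  c _ = ∈⊤
  spare⊆fibre false c j∈ = j∈

  fibres : ∀ {m} → Subset m → (Fin m → Bool) → Vec (Subset (4 + k)) m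
  fibres S c = tabulate λ g → fibre (lookup S g) (c g)

  blowUp : ∀ {m} → Subset m → (Fin m → Bool) → Subset (m * (4 + k))
  blowUp S c = concat (fibres S c)

  ∣fibre∣ : ∀ s c → ∣ fibre s c ∣ ≡ 2 * ∣ s ∷ [] ∣ + (2 + k)
  ∣fibre∣ true  c = ∣⊤∣≡n (4 + k)
  ∣fibre∣ false c = ∣spare∣ c

  ∣blowUp∣ : ∀ {m} (S : Subset m) c → ∣ blowUp S c ∣ ≡ (2 + k) * m + 2 * ∣ S ∣
  ∣blowUp∣ []      c = sym (trans (+-identityʳ _) (*-zeroʳ (2 + k)))
  ∣blowUp∣ {suc m} (s ∷ S) c = begin
    ∣ fibre s (c zero) ++ blowUp S (c ∘′ suc) ∣              ≡⟨ ∣++∣ (fibre s (c zero)) _ ⟩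
    ∣ fibre s (c zero) ∣ + ∣ blowUp S (c ∘′ suc) ∣          ≡⟨ cong₂ _+_ (∣fibre∣ s (c zero)) (∣blowUp∣ S _) ⟩
    (2 * ∣ s ∷ [] ∣ + (2 + k)) + ((2 + k) * m + 2 * ∣ S ∣)  ≡⟨ rearrange k m ∣ s ∷ [] ∣ ∣ S ∣ ⟩
    (2 + k) * suc m + 2 * (∣ s ∷ [] ∣ + ∣ S ∣)              ≡⟨ cong (λ t → (2 + k) * suc m + 2 * t) (∣++∣ (s ∷ []) S) ⟨
    (2 + k) * suc m + 2 * ∣ s ∷ S ∣                         ∎
    where
    open ≡-Reasoning
    rearrange : ∀ k m t u → (2 * t + (2 + k)) + ((2 + k) * m + 2 * u) ≡ (2 + k) * suc m + 2 * (t + u)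
    rearrange = solve-∀

  module _ {m} (S : Subset m) (c : Fin m → Bool) (g : Fin m) {j : Fin (4 + k)} where

    fibre⇒∈blowUp : j ∈ fibre (lookup S g) (c g) → combine g j ∈ blowUp S c
    fibre⇒∈blowUp j∈ = lookup⇒[]= (combine g j) (blowUp S c)
      (trans (lookup-concat (fibres S c) g j) (trans (cong (λ p → lookup p j) (lookup∘tabulate _ g)) ([]=⇒lookup j∈)))

    ∈S⇒∈blowUp : g ∈ S → combine g j ∈ blowUp S c
    ∈S⇒∈blowUp g∈S = fibre⇒∈blowUp (subst (λ s → j ∈ fibre s (c g)) (sym ([]=⇒lookup g∈S)) ∈⊤)

    spare⇒∈blowUp : j ∈ spare (c g) → combine g j ∈ blowUp S c
    spare⇒∈blowUp j∈ = fibre⇒∈blowUp (spare⊆fibre (lookup S g) (c g) j∈)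

module _ {G : Graph} {S : Subset (order G)} (ch : SkewChronology G S) (k : ℕ) where
  open SkewChronology ch
  open Colouring ch
  open BlowUp k
  open ProductForcing G (4 + k) (blowUp S colour)

  fibre-blue : ∀ w → (∀ {x} → rank x < rank w → ∀ l → BlueAt x l) → ∀ j → BlueAt w j
  fibre-blue w earlier-blue j with w ∈? S
  ... | yes w∈S = init (∈S⇒∈blowUp S colour w w∈S)
  ... | no w∉S with j ∈? spare (colour w)
  ...   | yes j∈ = init (spare⇒∈blowUp S colour w j∈)
  ...   | no j∉ with ∉spare⇒pair (colour w) j j∉
  ...     | b , refl =
    product-force (proj₁ (forcer-forces w∉S)) (pair-≢ (colour w) b) source-blue
      (λ y vy y≢w → earlier-blue (proj₂ (forcer-forces w∉S) y vy y≢w))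
      (λ l l≢a l≢b → init (spare⇒∈blowUp S colour w (spare-⊇ (colour w) b l≢a l≢b)))
    where
    source-blue : BlueAt (forcer w) (pair (colour w) (not b))
    source-blue with forcer w ∈? S | colour (forcer w) Bool.≟ colour w
    ... | yes v∈S | _         = init (∈S⇒∈blowUp S colour (forcer w) v∈S)
    ... | no v∉S  | yes same  = earlier-blue (same-colour⇒forcer-earlier w∉S v∉S same) _
    ... | no _    | no differ = init (spare⇒∈blowUp S colour (forcer w) (pair∈spare (colour w) (not b) differ))

  blowUp-isZeroForcingSet : IsZeroForcingSet (G ⊗ K (4 + k)) (blowUp S colour)
  blowUp-isZeroForcingSet =
    ∀-combine {order G} {4 + k} (All.wfRec (On.wellFounded rank <-wellFounded) _ _ fibre-blue)

theorem2p1 : (G : Graph) (n : ℕ) → 4 ≤ n → (z z⁻ : ℕ)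
    → IsZ (G ⊗ K n) z → IsZ⁻ G z⁻
    → z ≤ (n ∸ 2) * order G + 2 * z⁻
theorem2p1 G _ (s≤s (s≤s (s≤s (s≤s (z≤n {k}))))) z z⁻ (_ , z-minimal) ((S , ∣S∣≡z⁻ , S-forces) , _) = begin
  z                               ≤⟨ z-minimal (blowUp S colour) (blowUp-isZeroForcingSet ch k) ⟩
  ∣ blowUp S colour ∣             ≡⟨ ∣blowUp∣ S colour ⟩
  (2 + k) * order G + 2 * ∣ S ∣   ≡⟨ cong (λ t → (2 + k) * order G + 2 * t) ∣S∣≡z⁻ ⟩
  (2 + k) * order G + 2 * z⁻      ∎
  where
  ch = SkewRounds.skewChronology G S S-forces
  open Colouring ch
  open BlowUp k
  open ≤-Reasoning
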